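{- The map $F$ defined by $F(h)=\big((h^{rev})'-\rho+1\big)^{rev}$ is a bijection from the set of Hessenberg functions of length $n$ to the set of degree tuples of length $n$.
   Context: A Hessenberg function is an $n$-tuple $h=(h_1,\ldots,h_n)$ of integers with $i\le h_i\le n$ and $h_i\le h_{i+1}$. A degree tuple is an $n$-tuple $\beta=(\beta_n,\ldots,\beta_1)$ (entries listed with decreasing subscripts) with $1\le\beta_i\le i$ and $\beta_i-\beta_{i-1}\le1$. For $t=(t_1,\ldots,t_n)$, $t^{rev}=(t_n,\ldots,t_1)$. For a partition $\lambda=(\lambda_1,\ldots,\lambda_n)$ ($n\ge\lambda_1\ge\cdots\ge\lambda_n\ge0$), its conjugate $\lambda'$ has $\lambda'_i=\#\{k:\lambda_k\ge i\}$. $\rho=(n,n-1,\ldots,1)$, $1=(1,\ldots,1)$, and addition/subtraction are componentwise. Thus if $\lambda=(h^{rev})'$, then $F(h)=(\beta_n,\ldots,\beta_1)$ with $\beta_i=\lambda_i+i-n$. -}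

module Defs where

open import Data.Nat using (ℕ; zero; suc; _+_; _∸_; _≤_; _≤?_)
open import Data.Fin using (Fin; toℕ; opposite)
open import Data.Vec using (Vec; lookup; tabulate; reverse; zipWith; replicate; toList)
open import Data.List using (length; filter)
open import Relation.Binary.PropositionalEquality using (_≡_)

-- An n-tuple t = (t_1,…,t_n) is a Vec ℕ n; position k (1-based) is the
-- Fin index k-1.

rev : ∀ {n} → Vec ℕ n → Vec ℕ n
rev = reverse

conj : ∀ {n} → Vec ℕ n → Vec ℕ n
conj {n} lam = tabulate (λ (i : Fin n) → length (filter (λ x → suc (toℕ i) ≤? x) (toList lam)))

ρ : (n : ℕ) → Vec ℕ n
ρ n = tabulate (λ (k : Fin n) → n ∸ toℕ k)

𝟙 : (n : ℕ) → Vec ℕ n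
𝟙 n = replicate n 1

-- F(h) = ((h^rev)' - ρ + 1)^rev ; computed as ((h^rev)' + 1) ∸ ρ, which
-- never truncates on Hessenberg functions
F : ∀ {n} → Vec ℕ n → Vec ℕ n
F {n} h = rev (zipWith _∸_ (zipWith _+_ (conj (rev h)) (𝟙 n)) (ρ n))

-- Hessenberg function h = (h_1,…,h_n): subscript i (1-based) is Fin index i-1
record IsHessenberg {n : ℕ} (h : Vec ℕ n) : Set where
  field
    lower : ∀ (i : Fin n) → suc (toℕ i) ≤ lookup h i
    upper : ∀ (i : Fin n) → lookup h i ≤ n
    mono  : ∀ (i j : Fin n) → toℕ j ≡ suc (toℕ i) → lookup h i ≤ lookup h j

-- β_i for a tuple written β = (β_n,…,β_1) (decreasing subscripts):
-- for i : Fin n standing for subscript toℕ i + 1, β_{toℕ i + 1} sits at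
-- position n - toℕ i, i.e. Fin index opposite i.
βsub : ∀ {n} → Vec ℕ n → Fin n → ℕ
βsub β i = lookup β (opposite i)

record IsDegreeTuple {n : ℕ} (β : Vec ℕ n) : Set where
  field
    pos   : ∀ (i : Fin n) → 1 ≤ βsub β i
    bound : ∀ (i : Fin n) → βsub β i ≤ suc (toℕ i)
    step  : ∀ (i j : Fin n) → toℕ j ≡ suc (toℕ i) → βsub β j ≤ βsub β i + 1

-- Reversing a Hessenberg function h gives a partition λ = h^rev with ρ ⊆ λ ⊆ (n^n),
-- and conversely.  Conjugation is an involution on partitions inside the n × n box
-- and preserves the self-conjugate staircase ρ, so it permutes these partitions.
-- Finally λ ↦ (λ − ρ + 1)^rev identifies them with degree tuples: containing ρ
-- gives β_i ≥ 1, the box gives β_i ≤ i, and λ decreasing gives β_i − β_{i−1} ≤ 1.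
-- F is the composite of these three bijections.
module Submission where

open import Defs
open import Data.Nat using (ℕ; zero; suc; _+_; _∸_; _≤_; _<_; _≤?_; z≤n; s≤s; s≤s⁻¹)
open import Data.Nat.Properties
open import Data.Fin as Fin using (Fin; toℕ; opposite; fromℕ; fromℕ<; inject₁)
open import Data.Fin.Properties using (toℕ<n; toℕ-fromℕ<; opposite-prop; opposite-involutive)
open import Data.Vec using (Vec; []; _∷_; lookup; tabulate; reverse; zipWith; toList; _∷ʳ_)
open import Data.Vec.Properties
  using (reverse-∷; reverse-involutive; reverse-injective; reverse-reverse; lookup-zipWith; lookup-replicate;
         lookup∘tabulate; tabulate∘lookup; tabulate-cong; length-toList)
open import Data.List as List using (List; length; filter)
open import Data.List.Properties using (length-filter; filter-accept; filter-reject)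
open import Data.List.Relation.Binary.Sublist.Propositional using (⊆-refl)
open import Data.List.Relation.Binary.Sublist.Propositional.Properties using (filter⁺; length-mono-≤)
open import Data.Product using (Σ; _×_; _,_)
open import Function using (_⇔_; mk⇔; Equivalence; flip; _∘_)
open import Function.Properties.Equivalence using () renaming (sym to ⇔-sym; trans to ⇔-trans)
open import Relation.Nullary using (yes; no; contradiction)
open import Relation.Binary.PropositionalEquality using (_≡_; refl; sym; trans; cong; cong₂; subst; subst₂; module ≡-Reasoning)

open Equivalence using (to; from)

private variable
  n : ℕ

suc-opposite : (i : Fin n) → suc (toℕ (opposite i)) ≡ n ∸ toℕ i
suc-opposite {n} i = trans (cong suc (opposite-prop i)) (sym (+-∸-assoc 1 (toℕ<n i)))

∸-opposite : (i : Fin n) → n ∸ toℕ (opposite i) ≡ suc (toℕ i)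
∸-opposite {n} i = trans (cong (n ∸_) (opposite-prop i)) (m∸[m∸n]≡n (toℕ<n i))

suc+opposite : (i : Fin n) → suc (toℕ i) + toℕ (opposite i) ≡ n
suc+opposite {n} i = trans (cong (suc (toℕ i) +_) (opposite-prop i)) (m+[n∸m]≡n (toℕ<n i))

opposite-adjacent : {i j : Fin n} → toℕ j ≡ suc (toℕ i) → toℕ (opposite i) ≡ suc (toℕ (opposite j))
opposite-adjacent {n} {i} {j} j≡1+i = begin
  toℕ (opposite i)          ≡⟨ opposite-prop i ⟩
  n ∸ suc (toℕ i)           ≡⟨ cong (n ∸_) j≡1+i ⟨
  n ∸ toℕ j                 ≡⟨ suc-opposite j ⟨
  suc (toℕ (opposite j))    ∎
  where open ≡-Reasoning

m∸n≤1+[m∸1+n] : ∀ m k → m ∸ k ≤ suc (m ∸ suc k)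
m∸n≤1+[m∸1+n] zero    zero    = z≤n
m∸n≤1+[m∸1+n] zero    (suc k) = z≤n
m∸n≤1+[m∸1+n] (suc m) zero    = ≤-refl
m∸n≤1+[m∸1+n] (suc m) (suc k) = m∸n≤1+[m∸1+n] m k

lookup-∷ʳ-fromℕ : ∀ {A : Set} (xs : Vec A n) x → lookup (xs ∷ʳ x) (fromℕ n) ≡ x
lookup-∷ʳ-fromℕ []       x = refl
lookup-∷ʳ-fromℕ (y ∷ xs) x = lookup-∷ʳ-fromℕ xs x

lookup-∷ʳ-inject₁ : ∀ {A : Set} (xs : Vec A n) x i → lookup (xs ∷ʳ x) (inject₁ i) ≡ lookup xs i
lookup-∷ʳ-inject₁ (y ∷ xs) x Fin.zero    = refl
lookup-∷ʳ-inject₁ (y ∷ xs) x (Fin.suc i) = lookup-∷ʳ-inject₁ xs x i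

lookup-reverse-opposite : ∀ {A : Set} (xs : Vec A n) i → lookup (reverse xs) (opposite i) ≡ lookup xs i
lookup-reverse-opposite (x ∷ xs) i rewrite reverse-∷ x xs with i
... | Fin.zero  = lookup-∷ʳ-fromℕ (reverse xs) x
... | Fin.suc j = trans (lookup-∷ʳ-inject₁ (reverse xs) x (opposite j)) (lookup-reverse-opposite xs j)

lookup-reverse : ∀ {A : Set} (xs : Vec A n) i → lookup (reverse xs) i ≡ lookup xs (opposite i)
lookup-reverse xs i =
  trans (cong (lookup (reverse xs)) (sym (opposite-involutive i))) (lookup-reverse-opposite xs (opposite i))

lookup-ext : ∀ {A : Set} {xs ys : Vec A n} → (∀ i → lookup xs i ≡ lookup ys i) → xs ≡ ys
lookup-ext {xs = xs} {ys} eq = trans (sym (tabulate∘lookup xs)) (trans (tabulate-cong eq) (tabulate∘lookup ys))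

Decreasing : Vec ℕ n → Set
Decreasing {n} a = ∀ (i j : Fin n) → toℕ j ≡ suc (toℕ i) → lookup a j ≤ lookup a i

reverse-adjacent : (R : ℕ → ℕ → Set) (v : Vec ℕ n) →
  (∀ (i j : Fin n) → toℕ j ≡ suc (toℕ i) → R (lookup v i) (lookup v j)) →
  (∀ (i j : Fin n) → toℕ j ≡ suc (toℕ i) → R (lookup (reverse v) j) (lookup (reverse v) i))
reverse-adjacent R v adj i j j≡1+i =
  subst₂ R (sym (lookup-reverse v j)) (sym (lookup-reverse v i))
    (adj (opposite j) (opposite i) (opposite-adjacent j≡1+i))

decreasing-tail : ∀ {y} {ys : Vec ℕ n} → Decreasing (y ∷ ys) → Decreasing ys
decreasing-tail dec i j j≡1+i = dec (Fin.suc i) (Fin.suc j) (cong suc j≡1+i)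

lookup≤head : ∀ {y} {ys : Vec ℕ n} → Decreasing (y ∷ ys) → ∀ i → lookup (y ∷ ys) i ≤ y
lookup≤head                 dec Fin.zero    = ≤-refl
lookup≤head {ys = z ∷ zs} dec (Fin.suc i) =
  ≤-trans (lookup≤head (decreasing-tail dec) i) (dec Fin.zero (Fin.suc Fin.zero) refl)

count≥ : ℕ → List ℕ → ℕ
count≥ s xs = length (filter (s ≤?_) xs)

count≥-accept : ∀ {s x} xs → s ≤ x → count≥ s (x List.∷ xs) ≡ suc (count≥ s xs)
count≥-accept xs s≤x = cong length (filter-accept (_ ≤?_) {xs = xs} s≤x)

count≥-below : ∀ {s} (v : Vec ℕ n) → (∀ i → lookup v i < s) → count≥ s (toList v) ≡ 0
count≥-below []       below = refl
count≥-below (x ∷ xs) below = trans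
  (cong length (filter-reject (_ ≤?_) {xs = toList xs} (<⇒≱ (below Fin.zero))))
  (count≥-below xs (λ i → below (Fin.suc i)))

count≥-antitone : ∀ {s t} xs → s ≤ t → count≥ t xs ≤ count≥ s xs
count≥-antitone {s} {t} xs s≤t =
  length-mono-≤ (filter⁺ (t ≤?_) (s ≤?_) (λ { refl t≤x → ≤-trans s≤t t≤x }) (⊆-refl {x = xs}))

count≥≤length : ∀ s (v : Vec ℕ n) → count≥ s (toList v) ≤ n
count≥≤length s v = subst (count≥ s (toList v) ≤_) (length-toList v) (length-filter (s ≤?_) (toList v))

-- For a decreasing sequence the entries ≥ s form an initial segment of length count≥ s.
≤-lookup⇔<-count≥ : (a : Vec ℕ n) → Decreasing a → ∀ s i → s ≤ lookup a i ⇔ toℕ i < count≥ s (toList a)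
≤-lookup⇔<-count≥ (y ∷ ys) dec s i with s ≤? y | i
... | yes s≤y | Fin.zero  =
  mk⇔ (λ _ → subst (0 <_) (sym (count≥-accept (toList ys) s≤y)) (s≤s z≤n)) (λ _ → s≤y)
... | yes s≤y | Fin.suc i =
  mk⇔ (λ s≤ysᵢ → subst (suc (toℕ i) <_) (sym accept) (s≤s (to ih s≤ysᵢ)))
      (λ i<count → from ih (s≤s⁻¹ (subst (suc (toℕ i) <_) accept i<count)))
  where
  accept = count≥-accept (toList ys) s≤y
  ih = ≤-lookup⇔<-count≥ ys (decreasing-tail dec) s i
... | no s≰y  | i         =
  mk⇔ (λ s≤aᵢ → contradiction (≤-trans s≤aᵢ (lookup≤head dec i)) s≰y)
      (λ i<count → contradiction (subst (toℕ i <_) none i<count) n≮0)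
  where
  none : count≥ s (toList (y ∷ ys)) ≡ 0
  none = count≥-below (y ∷ ys) (λ j → ≤-<-trans (lookup≤head dec j) (≰⇒> s≰y))

lookup-conj : (a : Vec ℕ n) (i : Fin n) → lookup (conj a) i ≡ count≥ (suc (toℕ i)) (toList a)
lookup-conj a = lookup∘tabulate (λ i → count≥ (suc (toℕ i)) (toList a))

conj-bounded : (a : Vec ℕ n) (i : Fin n) → lookup (conj a) i ≤ n
conj-bounded {n} a i = subst (_≤ n) (sym (lookup-conj a i)) (count≥≤length _ a)

conj-decreasing : (a : Vec ℕ n) → Decreasing (conj a)
conj-decreasing a i j j≡1+i = subst₂ _≤_ (sym (lookup-conj a j)) (sym (lookup-conj a i))
  (count≥-antitone (toList a) (≤-trans (n≤1+n _) (≤-reflexive (cong suc (sym j≡1+i)))))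

conj-transpose : (a : Vec ℕ n) → Decreasing a → ∀ i j → toℕ i < lookup (conj a) j ⇔ toℕ j < lookup a i
conj-transpose a dec i j = subst (λ c → toℕ i < c ⇔ toℕ j < lookup a i) (sym (lookup-conj a j))
  (⇔-sym (≤-lookup⇔<-count≥ a dec (suc (toℕ j)) i))

≤-from-thresholds : ∀ {x y} → y ≤ n → (∀ (j : Fin n) → toℕ j < y → toℕ j < x) → y ≤ x
≤-from-thresholds {y = zero}      _   _     = z≤n
≤-from-thresholds {x = x} {suc y} y<n below = subst (_< x) (toℕ-fromℕ< y<n)
  (below (fromℕ< y<n) (subst (_< suc y) (sym (toℕ-fromℕ< y<n)) ≤-refl))

≡-from-thresholds : ∀ {x y} → x ≤ n → y ≤ n → (∀ (j : Fin n) → toℕ j < x ⇔ toℕ j < y) → x ≡ y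
≡-from-thresholds x≤n y≤n same = ≤-antisym
  (≤-from-thresholds x≤n (λ j → to (same j)))
  (≤-from-thresholds y≤n (λ j → from (same j)))

conj-involutive : (a : Vec ℕ n) → Decreasing a → (∀ i → lookup a i ≤ n) → conj (conj a) ≡ a
conj-involutive a dec bounded = lookup-ext λ i →
  ≡-from-thresholds (conj-bounded (conj a) i) (bounded i) λ j →
    ⇔-trans (conj-transpose (conj a) (conj-decreasing a) j i) (conj-transpose a dec i j)

-- Partitions λ with ρ ⊆ λ ⊆ (nⁿ); ρ has entry n − i = suc (toℕ (opposite i)) at index i.
record IsStaircasePartition (a : Vec ℕ n) : Set where
  field
    decreasing : Decreasing a
    bounded    : ∀ i → lookup a i ≤ n
    staircase  : ∀ i → toℕ (opposite i) < lookup a i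

conj-staircasePartition : {a : Vec ℕ n} → IsStaircasePartition a → IsStaircasePartition (conj a)
conj-staircasePartition {a = a} P = record
  { decreasing = conj-decreasing a
  ; bounded    = conj-bounded a
  ; staircase  = λ i → from (conj-transpose a decreasing (opposite i) i)
      (subst (_< lookup a (opposite i)) (cong toℕ (opposite-involutive i)) (staircase (opposite i)))
  }
  where open IsStaircasePartition P

reverse-hessenberg : {h : Vec ℕ n} → IsHessenberg h → IsStaircasePartition (reverse h)
reverse-hessenberg {n} {h} H = record
  { decreasing = reverse-adjacent _≤_ h mono
  ; bounded    = λ i → subst (_≤ n) (sym (lookup-reverse h i)) (upper (opposite i))
  ; staircase  = λ i → subst (toℕ (opposite i) <_) (sym (lookup-reverse h i)) (lower (opposite i))
  }
  where open IsHessenberg H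

reverse-staircasePartition : {a : Vec ℕ n} → IsStaircasePartition a → IsHessenberg (reverse a)
reverse-staircasePartition {a = a} P = record
  { lower = λ k → subst₂ _<_ (cong toℕ (opposite-involutive k)) (sym (lookup-reverse a k)) (staircase (opposite k))
  ; upper = λ k → subst (_≤ _) (sym (lookup-reverse a k)) (bounded (opposite k))
  ; mono  = reverse-adjacent (flip _≤_) a decreasing
  }
  where open IsStaircasePartition P

shift : Vec ℕ n → Vec ℕ n
shift {n} a = zipWith _∸_ (zipWith _+_ a (𝟙 n)) (ρ n)

lookup-shift : (a : Vec ℕ n) (i : Fin n) → lookup (shift a) i ≡ lookup a i ∸ toℕ (opposite i)
lookup-shift {n} a i = begin
  lookup (shift a) i                              ≡⟨ lookup-zipWith _∸_ i (zipWith _+_ a (𝟙 n)) (ρ n) ⟩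
  lookup (zipWith _+_ a (𝟙 n)) i ∸ lookup (ρ n) i ≡⟨ cong₂ _∸_ lookup-a+1 (lookup∘tabulate (λ k → n ∸ toℕ k) i) ⟩
  (lookup a i + 1) ∸ (n ∸ toℕ i)                  ≡⟨ cong₂ _∸_ (+-comm (lookup a i) 1) (sym (suc-opposite i)) ⟩
  suc (lookup a i) ∸ suc (toℕ (opposite i))       ∎
  where
  open ≡-Reasoning
  lookup-a+1 : lookup (zipWith _+_ a (𝟙 n)) i ≡ lookup a i + 1
  lookup-a+1 = trans (lookup-zipWith _+_ i a (𝟙 n)) (cong (lookup a i +_) (lookup-replicate i 1))

βsub-reverse-shift : (a : Vec ℕ n) (i : Fin n) → βsub (reverse (shift a)) i ≡ lookup a i ∸ toℕ (opposite i)
βsub-reverse-shift a i = trans (lookup-reverse-opposite (shift a) i) (lookup-shift a i)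

reverse-shift-degreeTuple : {a : Vec ℕ n} → IsStaircasePartition a → IsDegreeTuple (reverse (shift a))
reverse-shift-degreeTuple {a = a} P = record
  { pos   = λ i → subst (1 ≤_) (sym (βsub-reverse-shift a i)) (m<n⇒0<n∸m (staircase i))
  ; bound = λ i → subst₂ _≤_ (sym (βsub-reverse-shift a i)) (∸-opposite i)
                    (∸-monoˡ-≤ (toℕ (opposite i)) (bounded i))
  ; step  = step
  }
  where
  open IsStaircasePartition P
  step : ∀ i j → toℕ j ≡ suc (toℕ i) → βsub (reverse (shift a)) j ≤ βsub (reverse (shift a)) i + 1
  step i j j≡1+i = begin
    βsub (reverse (shift a)) j                 ≡⟨ βsub-reverse-shift a j ⟩
    lookup a j ∸ toℕ (opposite j)              ≤⟨ ∸-monoˡ-≤ (toℕ (opposite j)) (decreasing i j j≡1+i) ⟩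
    lookup a i ∸ toℕ (opposite j)              ≤⟨ m∸n≤1+[m∸1+n] (lookup a i) (toℕ (opposite j)) ⟩
    suc (lookup a i ∸ suc (toℕ (opposite j)))  ≡⟨ cong (λ k → suc (lookup a i ∸ k)) (opposite-adjacent j≡1+i) ⟨
    suc (lookup a i ∸ toℕ (opposite i))        ≡⟨ +-comm 1 _ ⟩
    (lookup a i ∸ toℕ (opposite i)) + 1        ≡⟨ cong (_+ 1) (βsub-reverse-shift a i) ⟨
    βsub (reverse (shift a)) i + 1             ∎
    where open ≤-Reasoning

shift-injective : {a b : Vec ℕ n} → (∀ i → toℕ (opposite i) < lookup a i) → (∀ i → toℕ (opposite i) < lookup b i) →
                  shift a ≡ shift b → a ≡ b
shift-injective {a = a} {b} a-stair b-stair eq = lookup-ext λ i → ∸-cancelʳ-≡ (<⇒≤ (a-stair i)) (<⇒≤ (b-stair i))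
  (trans (sym (lookup-shift a i)) (trans (cong (λ v → lookup v i) eq) (lookup-shift b i)))

unshift : Vec ℕ n → Vec ℕ n
unshift β = tabulate (λ i → βsub β i + toℕ (opposite i))

lookup-unshift : (β : Vec ℕ n) (i : Fin n) → lookup (unshift β) i ≡ βsub β i + toℕ (opposite i)
lookup-unshift β = lookup∘tabulate (λ i → βsub β i + toℕ (opposite i))

unshift-staircasePartition : {β : Vec ℕ n} → IsDegreeTuple β → IsStaircasePartition (unshift β)
unshift-staircasePartition {n} {β} D = record
  { decreasing = decreasing
  ; bounded    = λ i → subst₂ _≤_ (sym (lookup-unshift β i)) (suc+opposite i) (+-monoˡ-≤ (toℕ (opposite i)) (bound i))
  ; staircase  = λ i → subst (toℕ (opposite i) <_) (sym (lookup-unshift β i)) (m<n+m (toℕ (opposite i)) (pos i))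
  }
  where
  open IsDegreeTuple D
  decreasing : Decreasing (unshift β)
  decreasing i j j≡1+i = begin
    lookup (unshift β) j                  ≡⟨ lookup-unshift β j ⟩
    βsub β j + toℕ (opposite j)           ≤⟨ +-monoˡ-≤ (toℕ (opposite j)) (step i j j≡1+i) ⟩
    βsub β i + 1 + toℕ (opposite j)       ≡⟨ +-assoc (βsub β i) 1 (toℕ (opposite j)) ⟩
    βsub β i + suc (toℕ (opposite j))     ≡⟨ cong (βsub β i +_) (opposite-adjacent j≡1+i) ⟨
    βsub β i + toℕ (opposite i)           ≡⟨ lookup-unshift β i ⟨
    lookup (unshift β) i                  ∎
    where open ≤-Reasoning

reverse-shift-unshift : (β : Vec ℕ n) → reverse (shift (unshift β)) ≡ β
reverse-shift-unshift β = reverse-reverse {ys = shift (unshift β)} (lookup-ext λ i → begin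
  lookup (reverse β) i                                ≡⟨ lookup-reverse β i ⟩
  βsub β i                                            ≡⟨ m+n∸n≡m (βsub β i) (toℕ (opposite i)) ⟨
  βsub β i + toℕ (opposite i) ∸ toℕ (opposite i)      ≡⟨ cong (_∸ toℕ (opposite i)) (lookup-unshift β i) ⟨
  lookup (unshift β) i ∸ toℕ (opposite i)             ≡⟨ lookup-shift (unshift β) i ⟨
  lookup (shift (unshift β)) i                        ∎)
  where open ≡-Reasoning

corollary2p8 : (n : ℕ) →
    ((h : Vec ℕ n) → IsHessenberg h → IsDegreeTuple (F h))
    × ((h h′ : Vec ℕ n) → IsHessenberg h → IsHessenberg h′ → F h ≡ F h′ → h ≡ h′)
    × ((β : Vec ℕ n) → IsDegreeTuple β → Σ (Vec ℕ n) (λ h → IsHessenberg h × F h ≡ β))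
-- F h unfolds to reverse (shift (conj (reverse h))).
corollary2p8 n = isDegreeTuple , injective , surjective
  where
  open IsStaircasePartition

  isDegreeTuple : (h : Vec ℕ n) → IsHessenberg h → IsDegreeTuple (F h)
  isDegreeTuple h H = reverse-shift-degreeTuple (conj-staircasePartition (reverse-hessenberg H))

  conj-reverse-involutive : {h : Vec ℕ n} → IsHessenberg h → conj (conj (reverse h)) ≡ reverse h
  conj-reverse-involutive {h} H = conj-involutive (reverse h) (decreasing P) (bounded P)
    where P = reverse-hessenberg H

  injective : (h h′ : Vec ℕ n) → IsHessenberg h → IsHessenberg h′ → F h ≡ F h′ → h ≡ h′
  injective h h′ H H′ Fh≡Fh′ = reverse-injective (begin
    reverse h                    ≡⟨ conj-reverse-involutive H ⟨
    conj (conj (reverse h))      ≡⟨ cong conj (shift-injective (staircase P) (staircase P′) shift-eq) ⟩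
    conj (conj (reverse h′))     ≡⟨ conj-reverse-involutive H′ ⟩
    reverse h′                   ∎)
    where
    open ≡-Reasoning
    P = conj-staircasePartition (reverse-hessenberg H)
    P′ = conj-staircasePartition (reverse-hessenberg H′)
    shift-eq : shift (conj (reverse h)) ≡ shift (conj (reverse h′))
    shift-eq = reverse-injective Fh≡Fh′

  surjective : (β : Vec ℕ n) → IsDegreeTuple β → Σ (Vec ℕ n) (λ h → IsHessenberg h × F h ≡ β)
  surjective β D = reverse (conj a) , reverse-staircasePartition (conj-staircasePartition P) , (begin
    F (reverse (conj a))                      ≡⟨ cong (reverse ∘ shift ∘ conj) (reverse-involutive (conj a)) ⟩
    reverse (shift (conj (conj a)))           ≡⟨ cong (reverse ∘ shift) (conj-involutive a (decreasing P) (bounded P)) ⟩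
    reverse (shift a)                         ≡⟨ reverse-shift-unshift β ⟩
    β                                         ∎)
    where
    open ≡-Reasoning
    a = unshift β
    P = unshift-staircasePartition D
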